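{- For any intermediate propositional logic $L$, if some modal companion of $L$ has the uniform Lyndon interpolation property, then $L$ also has the uniform Lyndon interpolation property.
   Context: Intermediate formulas are built from variables, $\bot$, $\land,\lor,\neg,\to$; modal formulas additionally use $\Box$. Polarity: $v^+(p)=\{p\}$, $v^-(p)=\emptyset$, $v^\circ(\bot)=\emptyset$, $\land,\lor,\Box$ preserve polarity, $v^\pm(\neg\varphi)=v^\mp(\varphi)$, $v^+(\varphi\to\psi)=v^-(\varphi)\cup v^+(\psi)$, $v^-(\varphi\to\psi)=v^+(\varphi)\cup v^-(\psi)$. An intermediate propositional logic is a set of formulas containing $\mathbf{Int}$, contained in classical logic, closed under modus ponens and substitution. Gödel's translation $\mathsf{T}$: $\mathsf{T}(p)=\Box p$, $\mathsf{T}(\bot)=\bot$, $\mathsf{T}(\varphi\land\psi)=\mathsf{T}(\varphi)\land\mathsf{T}(\psi)$, $\mathsf{T}(\varphi\lor\psi)=\mathsf{T}(\varphi)\lor\mathsf{T}(\psi)$, $\mathsf{T}(\neg\varphi)=\Box\neg\mathsf{T}(\varphi)$, $\mathsf{T}(\varphi\to\psi)=\Box(\mathsf{T}(\varphi)\to\mathsf{T}(\psi))$. A normal modal logic $M\supseteq\mathbf{S4}$ is a modal companion of $L$ iff for every intermediate formula $\varphi$, $L\vdash\varphi\iff M\vdash\mathsf{T}(\varphi)$. A logic $L$ (intermediate or modal) has the uniform Lyndon interpolation property iff for every formula $\varphi$ and finite sets $P^+,P^-$ of variables there is $\theta$ (in the same language) with $L\vdash\varphi\to\theta$, $v^\circ(\theta)\subseteq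 v^\circ(\varphi)\setminus P^\circ$ for $\circ\in\{+,-\}$, and $L\vdash\theta\to\psi$ for every $\psi$ with $L\vdash\varphi\to\psi$ and $v^\circ(\psi)\cap P^\circ=\emptyset$ for $\circ\in\{+,-\}$. -}

module Defs where

open import Data.Nat using (ℕ)
open import Data.Bool using (Bool; true; false; _∧_; _∨_; not)
open import Data.Product using (Σ; _×_; _,_)
open import Data.Sum using (_⊎_)
open import Data.Empty using (⊥)
open import Data.List using (List)
open import Data.List.Membership.Propositional using (_∈_; _∉_)
open import Relation.Binary.PropositionalEquality using (_≡_)

infixr 5 _⇒_
infixr 6 _∨'_
infixr 7 _∧'_

data IFm : Set where
  var  : ℕ → IFm
  ⊥'   : IFm
  _∧'_ : IFm → IFm → IFm
  _∨'_ : IFm → IFm → IFm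
  ¬'_  : IFm → IFm
  _⇒_  : IFm → IFm → IFm

infixr 5 _⇒ₘ_
infixr 6 _∨ₘ_
infixr 7 _∧ₘ_

data MFm : Set where
  var  : ℕ → MFm
  ⊥ₘ   : MFm
  _∧ₘ_ : MFm → MFm → MFm
  _∨ₘ_ : MFm → MFm → MFm
  ¬ₘ_  : MFm → MFm
  _⇒ₘ_ : MFm → MFm → MFm
  □_   : MFm → MFm

Pos Neg : ℕ → IFm → Set
Pos p (var q)  = p ≡ q
Pos p ⊥'       = ⊥
Pos p (φ ∧' ψ) = Pos p φ ⊎ Pos p ψ
Pos p (φ ∨' ψ) = Pos p φ ⊎ Pos p ψ
Pos p (¬' φ)   = Neg p φ
Pos p (φ ⇒ ψ)  = Neg p φ ⊎ Pos p ψ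
Neg p (var q)  = ⊥
Neg p ⊥'       = ⊥
Neg p (φ ∧' ψ) = Neg p φ ⊎ Neg p ψ
Neg p (φ ∨' ψ) = Neg p φ ⊎ Neg p ψ
Neg p (¬' φ)   = Pos p φ
Neg p (φ ⇒ ψ)  = Pos p φ ⊎ Neg p ψ

Posₘ Negₘ : ℕ → MFm → Set
Posₘ p (var q)  = p ≡ q
Posₘ p ⊥ₘ       = ⊥
Posₘ p (φ ∧ₘ ψ) = Posₘ p φ ⊎ Posₘ p ψ
Posₘ p (φ ∨ₘ ψ) = Posₘ p φ ⊎ Posₘ p ψ
Posₘ p (¬ₘ φ)   = Negₘ p φ
Posₘ p (φ ⇒ₘ ψ) = Negₘ p φ ⊎ Posₘ p ψ
Posₘ p (□ φ)    = Posₘ p φ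
Negₘ p (var q)  = ⊥
Negₘ p ⊥ₘ       = ⊥
Negₘ p (φ ∧ₘ ψ) = Negₘ p φ ⊎ Negₘ p ψ
Negₘ p (φ ∨ₘ ψ) = Negₘ p φ ⊎ Negₘ p ψ
Negₘ p (¬ₘ φ)   = Posₘ p φ
Negₘ p (φ ⇒ₘ ψ) = Posₘ p φ ⊎ Negₘ p ψ
Negₘ p (□ φ)    = Negₘ p φ

subst : (ℕ → IFm) → IFm → IFm
subst σ (var p)  = σ p
subst σ ⊥'       = ⊥'
subst σ (φ ∧' ψ) = subst σ φ ∧' subst σ ψ
subst σ (φ ∨' ψ) = subst σ φ ∨' subst σ ψ
subst σ (¬' φ)   = ¬' subst σ φ
subst σ (φ ⇒ ψ)  = subst σ φ ⇒ subst σ ψ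

substₘ : (ℕ → MFm) → MFm → MFm
substₘ σ (var p)  = σ p
substₘ σ ⊥ₘ       = ⊥ₘ
substₘ σ (φ ∧ₘ ψ) = substₘ σ φ ∧ₘ substₘ σ ψ
substₘ σ (φ ∨ₘ ψ) = substₘ σ φ ∨ₘ substₘ σ ψ
substₘ σ (¬ₘ φ)   = ¬ₘ substₘ σ φ
substₘ σ (φ ⇒ₘ ψ) = substₘ σ φ ⇒ₘ substₘ σ ψ
substₘ σ (□ φ)    = □ substₘ σ φ

data Int⊢ : IFm → Set where
  ax1 : ∀ {φ ψ} → Int⊢ (φ ⇒ ψ ⇒ φ)
  ax2 : ∀ {φ ψ χ} → Int⊢ ((φ ⇒ ψ ⇒ χ) ⇒ (φ ⇒ ψ) ⇒ φ ⇒ χ)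
  ax3 : ∀ {φ ψ} → Int⊢ (φ ∧' ψ ⇒ φ)
  ax4 : ∀ {φ ψ} → Int⊢ (φ ∧' ψ ⇒ ψ)
  ax5 : ∀ {φ ψ} → Int⊢ (φ ⇒ ψ ⇒ φ ∧' ψ)
  ax6 : ∀ {φ ψ} → Int⊢ (φ ⇒ φ ∨' ψ)
  ax7 : ∀ {φ ψ} → Int⊢ (ψ ⇒ φ ∨' ψ)
  ax8 : ∀ {φ ψ χ} → Int⊢ ((φ ⇒ χ) ⇒ (ψ ⇒ χ) ⇒ φ ∨' ψ ⇒ χ)
  ax9 : ∀ {φ} → Int⊢ (⊥' ⇒ φ)
  neg1 : ∀ {φ} → Int⊢ (¬' φ ⇒ φ ⇒ ⊥')
  neg2 : ∀ {φ} → Int⊢ ((φ ⇒ ⊥') ⇒ ¬' φ)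
  mp  : ∀ {φ ψ} → Int⊢ (φ ⇒ ψ) → Int⊢ φ → Int⊢ ψ

eval : (ℕ → Bool) → IFm → Bool
eval v (var p)  = v p
eval v ⊥'       = false
eval v (φ ∧' ψ) = eval v φ ∧ eval v ψ
eval v (φ ∨' ψ) = eval v φ ∨ eval v ψ
eval v (¬' φ)   = not (eval v φ)
eval v (φ ⇒ ψ)  = not (eval v φ) ∨ eval v ψ

Cl : IFm → Set
Cl φ = ∀ (v : ℕ → Bool) → eval v φ ≡ true

record IsIntermediate (L : IFm → Set) : Set where
  field
    int⊆   : ∀ {φ} → Int⊢ φ → L φ
    ⊆cl    : ∀ {φ} → L φ → Cl φ
    mpClosed    : ∀ {φ ψ} → L (φ ⇒ ψ) → L φ → L ψ
    substClosed : ∀ σ {φ} → L φ → L (subst σ φ)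

data S4⊢ : MFm → Set where
  ax1 : ∀ {φ ψ} → S4⊢ (φ ⇒ₘ ψ ⇒ₘ φ)
  ax2 : ∀ {φ ψ χ} → S4⊢ ((φ ⇒ₘ ψ ⇒ₘ χ) ⇒ₘ (φ ⇒ₘ ψ) ⇒ₘ φ ⇒ₘ χ)
  ax3 : ∀ {φ ψ} → S4⊢ (φ ∧ₘ ψ ⇒ₘ φ)
  ax4 : ∀ {φ ψ} → S4⊢ (φ ∧ₘ ψ ⇒ₘ ψ)
  ax5 : ∀ {φ ψ} → S4⊢ (φ ⇒ₘ ψ ⇒ₘ φ ∧ₘ ψ)
  ax6 : ∀ {φ ψ} → S4⊢ (φ ⇒ₘ φ ∨ₘ ψ)
  ax7 : ∀ {φ ψ} → S4⊢ (ψ ⇒ₘ φ ∨ₘ ψ)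
  ax8 : ∀ {φ ψ χ} → S4⊢ ((φ ⇒ₘ χ) ⇒ₘ (ψ ⇒ₘ χ) ⇒ₘ φ ∨ₘ ψ ⇒ₘ χ)
  ax9 : ∀ {φ} → S4⊢ (⊥ₘ ⇒ₘ φ)
  neg1 : ∀ {φ} → S4⊢ (¬ₘ φ ⇒ₘ φ ⇒ₘ ⊥ₘ)
  neg2 : ∀ {φ} → S4⊢ ((φ ⇒ₘ ⊥ₘ) ⇒ₘ ¬ₘ φ)
  dne  : ∀ {φ} → S4⊢ (¬ₘ ¬ₘ φ ⇒ₘ φ)
  axK : ∀ {φ ψ} → S4⊢ (□ (φ ⇒ₘ ψ) ⇒ₘ □ φ ⇒ₘ □ ψ)
  axT : ∀ {φ} → S4⊢ (□ φ ⇒ₘ φ)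
  ax4' : ∀ {φ} → S4⊢ (□ φ ⇒ₘ □ □ φ)
  mp  : ∀ {φ ψ} → S4⊢ (φ ⇒ₘ ψ) → S4⊢ φ → S4⊢ ψ
  nec : ∀ {φ} → S4⊢ φ → S4⊢ (□ φ)

record IsNormalExtS4 (M : MFm → Set) : Set where
  field
    s4⊆   : ∀ {φ} → S4⊢ φ → M φ
    mpClosed    : ∀ {φ ψ} → M (φ ⇒ₘ ψ) → M φ → M ψ
    necClosed   : ∀ {φ} → M φ → M (□ φ)
    substClosed : ∀ σ {φ} → M φ → M (substₘ σ φ)

T : IFm → MFm
T (var p)  = □ var p
T ⊥'       = ⊥ₘ
T (φ ∧' ψ) = T φ ∧ₘ T ψ
T (φ ∨' ψ) = T φ ∨ₘ T ψ
T (¬' φ)   = □ (¬ₘ T φ)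
T (φ ⇒ ψ)  = □ (T φ ⇒ₘ T ψ)

ModalCompanion : (L : IFm → Set) → (M : MFm → Set) → Set
ModalCompanion L M =
  IsNormalExtS4 M × (∀ φ → (L φ → M (T φ)) × (M (T φ) → L φ))

ULIPFor : {F : Set} → (F → F → F) → (ℕ → F → Set) → (ℕ → F → Set)
        → (F → Set) → Set
ULIPFor {F} _⟶_ P N L =
  ∀ (φ : F) (P⁺ P⁻ : List ℕ) → Σ F λ θ →
    L (φ ⟶ θ)
    × (∀ p → P p θ → P p φ × p ∉ P⁺)
    × (∀ p → N p θ → N p φ × p ∉ P⁻)
    × (∀ (ψ : F) → L (φ ⟶ ψ)
         → (∀ p → P p ψ → p ∉ P⁺)
         → (∀ p → N p ψ → p ∉ P⁻)
         → L (θ ⟶ ψ))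

ULIP : (IFm → Set) → Set
ULIP = ULIPFor _⇒_ Pos Neg

ULIPₘ : (MFm → Set) → Set
ULIPₘ = ULIPFor _⇒ₘ_ Posₘ Negₘ

{-# OPTIONS --safe #-}

-- Let α be a uniform Lyndon interpolant of T φ in M, and let α* be α with every variable p
-- replaced by □p. Over S4, α* and ¬α* are equivalent to conjunctions of clauses T a → T b with
-- intermediate a, b: disjunction distributes over such conjunctions because
-- (T a → T b) ∨ (T a' → T b') ↔ (T (a ∧ a') → T (b ∨ b')), and a boxed subformula becomes a
-- single clause with antecedent ⊤ or consequent ⊥. So □α* is equivalent to T θ for the
-- intermediate formula θ = ⋀ (a → b), and every variable occurs in θ only with polarities it has
-- in α. As T-images are stable (T φ → □ T φ) and invariant under p ↦ □p, the companion
-- equivalence L ⊢ χ ⟺ M ⊢ T χ turns the interpolation properties of α into those of θ.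

module Submission where

open import Defs
open import Data.Bool using (Bool; true; false; _∧_; _∨_; not; if_then_else_) renaming (T to IsTrue)
open import Data.Empty using (⊥; ⊥-elim)
open import Data.List using (List; []; _∷_; _++_; map; cartesianProductWith)
open import Data.List.Membership.Propositional using (_∈_; _∉_; find; lose)
open import Data.List.Membership.Propositional.Properties using (∈-cartesianProductWith⁻)
open import Data.List.Relation.Unary.Any using (Any; here; there)
open import Data.List.Relation.Unary.Any.Properties using (++⁻; singleton⁻)
open import Data.Nat using (ℕ; zero; suc; _≤_; _<_; _<ᵇ_; _≟_; z≤n)
open import Data.Nat.Properties using (<ᵇ⇒<; <⇒≱; >⇒≢; m≤n⇒m<n∨m≡n; ≟-diag)
open import Data.Product using (Σ; _×_; _,_; proj₁; proj₂; swap; map₁)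
open import Data.Sum using (_⊎_; inj₁; inj₂; [_,_]′) renaming (map to ⊎-map)
open import Data.Unit using (⊤)
open import Function using (_∘_; id)
open import Level using (0ℓ)
open import Relation.Binary.Bundles using (Setoid; Preorder)
import Relation.Binary.Reasoning.Setoid
import Relation.Binary.Reasoning.Preorder
open import Relation.Binary.PropositionalEquality using (_≡_; _≢_; refl; cong; isEquivalence)
open import Relation.Nullary using (does)
open import Relation.Nullary.Decidable using (dec-false)

variable
  A B C D : MFm
  Γ : List MFm

infix 3 _⊢_

data _⊢_ (Γ : List MFm) : MFm → Set where
  hyp : A ∈ Γ → Γ ⊢ A
  thm : S4⊢ A → Γ ⊢ A
  app : Γ ⊢ A ⇒ₘ B → Γ ⊢ A → Γ ⊢ B

⇒-refl : S4⊢ (A ⇒ₘ A)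
⇒-refl {A} = mp (mp (ax2 {A} {A ⇒ₘ A} {A}) ax1) ax1

deduction : A ∷ Γ ⊢ B → Γ ⊢ A ⇒ₘ B
deduction (hyp (here refl)) = thm ⇒-refl
deduction (hyp (there B∈Γ)) = app (thm ax1) (hyp B∈Γ)
deduction (thm ⊢B)          = app (thm ax1) (thm ⊢B)
deduction (app d e)         = app (app (thm ax2) (deduction d)) (deduction e)

closed : [] ⊢ A → S4⊢ A
closed (thm ⊢A)  = ⊢A
closed (app d e) = mp (closed d) (closed e)

weaken : Γ ⊢ A → B ∷ Γ ⊢ A
weaken (hyp A∈Γ) = hyp (there A∈Γ)
weaken (thm ⊢A)  = thm ⊢A
weaken (app d e) = app (weaken d) (weaken e)

assumption : A ∷ Γ ⊢ A
assumption = hyp (here refl)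

¬-intro : A ∷ Γ ⊢ ⊥ₘ → Γ ⊢ ¬ₘ A
¬-intro d = app (thm neg2) (deduction d)

¬-elim : Γ ⊢ ¬ₘ A → Γ ⊢ A → Γ ⊢ ⊥ₘ
¬-elim d e = app (app (thm neg1) d) e

⊥ₘ-elim : Γ ⊢ ⊥ₘ → Γ ⊢ A
⊥ₘ-elim = app (thm ax9)

∨-elim : Γ ⊢ A ∨ₘ B → A ∷ Γ ⊢ C → B ∷ Γ ⊢ C → Γ ⊢ C
∨-elim d e f = app (app (app (thm ax8) (deduction e)) (deduction f)) d

excluded-middle : S4⊢ (A ∨ₘ ¬ₘ A)
excluded-middle = mp dne (closed (¬-intro (¬-elim assumption
  (app (thm ax7) (¬-intro (¬-elim (weaken assumption) (app (thm ax6) assumption)))))))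

by-cases : A ∷ Γ ⊢ C → ¬ₘ A ∷ Γ ⊢ C → Γ ⊢ C
by-cases = ∨-elim (thm excluded-middle)

⊤ₘ : MFm
⊤ₘ = ¬ₘ ⊥ₘ

⊤ₘ-intro : S4⊢ ⊤ₘ
⊤ₘ-intro = mp neg2 ⇒-refl

-- Truth-table tautologies are theorems of S4

literal : Bool → MFm → MFm
literal true  A = A
literal false A = ¬ₘ A

literal-true : ∀ b → IsTrue b → Γ ⊢ literal b A → Γ ⊢ A
literal-true true _ d = d

literal-∧ : ∀ a b → Γ ⊢ literal a A → Γ ⊢ literal b B → Γ ⊢ literal (a ∧ b) (A ∧ₘ B)
literal-∧ true  true  ⊢A  ⊢B  = app (app (thm ax5) ⊢A) ⊢B
literal-∧ true  false _   ⊢¬B = ¬-intro (¬-elim (weaken ⊢¬B) (app (thm ax4) assumption))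
literal-∧ false _     ⊢¬A _   = ¬-intro (¬-elim (weaken ⊢¬A) (app (thm ax3) assumption))

literal-∨ : ∀ a b → Γ ⊢ literal a A → Γ ⊢ literal b B → Γ ⊢ literal (a ∨ b) (A ∨ₘ B)
literal-∨ true  _     ⊢A  _   = app (thm ax6) ⊢A
literal-∨ false true  _   ⊢B  = app (thm ax7) ⊢B
literal-∨ false false ⊢¬A ⊢¬B = ¬-intro (∨-elim assumption
  (¬-elim (weaken (weaken ⊢¬A)) assumption) (¬-elim (weaken (weaken ⊢¬B)) assumption))

literal-¬ : ∀ a → Γ ⊢ literal a A → Γ ⊢ literal (not a) (¬ₘ A)
literal-¬ true  ⊢A  = ¬-intro (¬-elim assumption (weaken ⊢A))
literal-¬ false ⊢¬A = ⊢¬A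

literal-⇒ : ∀ a b → Γ ⊢ literal a A → Γ ⊢ literal b B → Γ ⊢ literal (not a ∨ b) (A ⇒ₘ B)
literal-⇒ false _     ⊢¬A _   = deduction (⊥ₘ-elim (¬-elim (weaken ⊢¬A) assumption))
literal-⇒ true  true  _   ⊢B  = app (thm ax1) ⊢B
literal-⇒ true  false ⊢A  ⊢¬B = ¬-intro (¬-elim (weaken ⊢¬B) (app assumption (weaken ⊢A)))

evalₘ : (ℕ → Bool) → MFm → Bool
evalₘ v (var p)  = v p
evalₘ v ⊥ₘ       = false
evalₘ v (φ ∧ₘ ψ) = evalₘ v φ ∧ evalₘ v ψ
evalₘ v (φ ∨ₘ ψ) = evalₘ v φ ∨ evalₘ v ψ
evalₘ v (¬ₘ φ)   = not (evalₘ v φ)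
evalₘ v (φ ⇒ₘ ψ) = not (evalₘ v φ) ∨ evalₘ v ψ
evalₘ v (□ φ)    = false

PropositionalBelow : ℕ → MFm → Set
PropositionalBelow n (var p)  = IsTrue (p <ᵇ n)
PropositionalBelow n ⊥ₘ       = ⊤
PropositionalBelow n (φ ∧ₘ ψ) = PropositionalBelow n φ × PropositionalBelow n ψ
PropositionalBelow n (φ ∨ₘ ψ) = PropositionalBelow n φ × PropositionalBelow n ψ
PropositionalBelow n (¬ₘ φ)   = PropositionalBelow n φ
PropositionalBelow n (φ ⇒ₘ ψ) = PropositionalBelow n φ × PropositionalBelow n ψ
PropositionalBelow n (□ φ)    = ⊥

kalmar : ∀ {n} v φ → PropositionalBelow n φ → (∀ i → i < n → Γ ⊢ literal (v i) (var i))
       → Γ ⊢ literal (evalₘ v φ) φ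
kalmar v (var p)  p<n       lits = lits p (<ᵇ⇒< p _ p<n)
kalmar v ⊥ₘ       _         _    = thm ⊤ₘ-intro
kalmar v (φ ∧ₘ ψ) (bφ , bψ) lits =
  literal-∧ (evalₘ v φ) (evalₘ v ψ) (kalmar v φ bφ lits) (kalmar v ψ bψ lits)
kalmar v (φ ∨ₘ ψ) (bφ , bψ) lits =
  literal-∨ (evalₘ v φ) (evalₘ v ψ) (kalmar v φ bφ lits) (kalmar v ψ bψ lits)
kalmar v (¬ₘ φ)   bφ        lits = literal-¬ (evalₘ v φ) (kalmar v φ bφ lits)
kalmar v (φ ⇒ₘ ψ) (bφ , bψ) lits =
  literal-⇒ (evalₘ v φ) (evalₘ v ψ) (kalmar v φ bφ lits) (kalmar v ψ bψ lits)

_[_≔_] : (ℕ → Bool) → ℕ → Bool → ℕ → Bool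
(v [ n ≔ b ]) i = if does (i ≟ n) then b else v i

[≔]-same : ∀ v n b → (v [ n ≔ b ]) n ≡ b
[≔]-same v n b = cong (λ d → if does d then b else v n) (≟-diag {n} refl)

[≔]-other : ∀ v {n i} b → i ≢ n → (v [ n ≔ b ]) i ≡ v i
[≔]-other v {n} {i} b i≢n = cong (λ c → if c then b else v i) (dec-false (i ≟ n) i≢n)

Valid : ℕ → (ℕ → Bool) → MFm → Set
Valid zero    v φ = IsTrue (evalₘ v φ)
Valid (suc n) v φ = Valid n (v [ n ≔ true ]) φ × Valid n (v [ n ≔ false ]) φ

eliminate : ∀ {N} n v φ → PropositionalBelow N φ → Valid n v φ
          → (∀ i → n ≤ i → i < N → Γ ⊢ literal (v i) (var i)) → Γ ⊢ φ
eliminate zero v φ bφ valid lits =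
  literal-true (evalₘ v φ) valid (kalmar v φ bφ (λ i → lits i z≤n))
eliminate {Γ = Γ} {N} (suc n) v φ bφ (valid-true , valid-false) lits =
  by-cases (eliminate n _ φ bφ valid-true  (lits-≔ true))
           (eliminate n _ φ bφ valid-false (lits-≔ false))
  where
  lits-≔ : ∀ b i → n ≤ i → i < N → literal b (var n) ∷ Γ ⊢ literal ((v [ n ≔ b ]) i) (var i)
  lits-≔ b i n≤i i<N with m≤n⇒m<n∨m≡n n≤i
  ... | inj₁ n<i  rewrite [≔]-other v b (>⇒≢ n<i) = weaken (lits i n<i i<N)
  ... | inj₂ refl rewrite [≔]-same v n b          = assumption

S4⊢-tautology : ∀ n φ → {PropositionalBelow n φ} → {Valid n (λ _ → false) φ} → S4⊢ φ
S4⊢-tautology n φ {bφ} {valid} =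
  closed (eliminate n _ φ bφ valid (λ i n≤i i<n → ⊥-elim (<⇒≱ i<n n≤i)))

S4⊢-subst : ∀ σ → S4⊢ A → S4⊢ (substₘ σ A)
S4⊢-subst σ ax1       = ax1
S4⊢-subst σ ax2       = ax2
S4⊢-subst σ ax3       = ax3
S4⊢-subst σ ax4       = ax4
S4⊢-subst σ ax5       = ax5
S4⊢-subst σ ax6       = ax6
S4⊢-subst σ ax7       = ax7
S4⊢-subst σ ax8       = ax8
S4⊢-subst σ ax9       = ax9
S4⊢-subst σ neg1      = neg1
S4⊢-subst σ neg2      = neg2
S4⊢-subst σ dne       = dne
S4⊢-subst σ axK       = axK
S4⊢-subst σ axT       = axT
S4⊢-subst σ ax4'      = ax4'
S4⊢-subst σ (mp d e)  = mp (S4⊢-subst σ d) (S4⊢-subst σ e)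
S4⊢-subst σ (nec d)   = nec (S4⊢-subst σ d)

assign : List MFm → ℕ → MFm
assign []       _       = ⊥ₘ
assign (A ∷ As) zero    = A
assign (A ∷ As) (suc i) = assign As i

-- For a concrete schema φ the implicit side conditions compute to ⊤ and are filled in by
-- Agda, which is how the propositional laws below are proved.
taut : ∀ n φ → {PropositionalBelow n φ} → {Valid n (λ _ → false) φ}
     → ∀ As → S4⊢ (substₘ (assign As) φ)
taut n φ {bφ} {valid} As = S4⊢-subst (assign As) (S4⊢-tautology n φ {bφ} {valid})

p₀ p₁ p₂ p₃ : MFm
p₀ = var 0
p₁ = var 1
p₂ = var 2
p₃ = var 3

mp₂ : S4⊢ (A ⇒ₘ B ⇒ₘ C) → S4⊢ A → S4⊢ B → S4⊢ C
mp₂ d e f = mp (mp d e) f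

syllogism : S4⊢ ((A ⇒ₘ B) ⇒ₘ (B ⇒ₘ C) ⇒ₘ A ⇒ₘ C)
syllogism {A} {B} {C} = taut 3 ((p₀ ⇒ₘ p₁) ⇒ₘ (p₁ ⇒ₘ p₂) ⇒ₘ p₀ ⇒ₘ p₂) (A ∷ B ∷ C ∷ [])

⇒-trans : S4⊢ (A ⇒ₘ B) → S4⊢ (B ⇒ₘ C) → S4⊢ (A ⇒ₘ C)
⇒-trans = mp₂ syllogism

∧-mono : S4⊢ (A ⇒ₘ B) → S4⊢ (C ⇒ₘ D) → S4⊢ (A ∧ₘ C ⇒ₘ B ∧ₘ D)
∧-mono {A} {B} {C} {D} =
  mp₂ (taut 4 ((p₀ ⇒ₘ p₁) ⇒ₘ (p₂ ⇒ₘ p₃) ⇒ₘ p₀ ∧ₘ p₂ ⇒ₘ p₁ ∧ₘ p₃) (A ∷ B ∷ C ∷ D ∷ []))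

∨-mono : S4⊢ (A ⇒ₘ B) → S4⊢ (C ⇒ₘ D) → S4⊢ (A ∨ₘ C ⇒ₘ B ∨ₘ D)
∨-mono {A} {B} {C} {D} =
  mp₂ (taut 4 ((p₀ ⇒ₘ p₁) ⇒ₘ (p₂ ⇒ₘ p₃) ⇒ₘ p₀ ∨ₘ p₂ ⇒ₘ p₁ ∨ₘ p₃) (A ∷ B ∷ C ∷ D ∷ []))

⇒-mono : S4⊢ (B ⇒ₘ A) → S4⊢ (C ⇒ₘ D) → S4⊢ ((A ⇒ₘ C) ⇒ₘ B ⇒ₘ D)
⇒-mono {B} {A} {C} {D} =
  mp₂ (taut 4 ((p₀ ⇒ₘ p₁) ⇒ₘ (p₂ ⇒ₘ p₃) ⇒ₘ (p₁ ⇒ₘ p₂) ⇒ₘ p₀ ⇒ₘ p₃) (B ∷ A ∷ C ∷ D ∷ []))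

¬-antitone : S4⊢ (A ⇒ₘ B) → S4⊢ (¬ₘ B ⇒ₘ ¬ₘ A)
¬-antitone {A} {B} = mp (taut 2 ((p₀ ⇒ₘ p₁) ⇒ₘ ¬ₘ p₁ ⇒ₘ ¬ₘ p₀) (A ∷ B ∷ []))

□-mono : S4⊢ (A ⇒ₘ B) → S4⊢ (□ A ⇒ₘ □ B)
□-mono d = mp axK (nec d)

infix 4 _≈_

_≈_ : MFm → MFm → Set
A ≈ B = S4⊢ (A ⇒ₘ B) × S4⊢ (B ⇒ₘ A)

≈-refl : A ≈ A
≈-refl = ⇒-refl , ⇒-refl

≈-sym : A ≈ B → B ≈ A
≈-sym = swap

≈-trans : A ≈ B → B ≈ C → A ≈ C
≈-trans (f , f⁻) (g , g⁻) = ⇒-trans f g , ⇒-trans g⁻ f⁻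

≈-setoid : Setoid 0ℓ 0ℓ
≈-setoid = record
  { Carrier       = MFm
  ; _≈_           = _≈_
  ; isEquivalence = record { refl = ≈-refl ; sym = ≈-sym ; trans = ≈-trans }
  }

module ≈-Reasoning = Relation.Binary.Reasoning.Setoid ≈-setoid

∧-cong : A ≈ B → C ≈ D → A ∧ₘ C ≈ B ∧ₘ D
∧-cong (f , f⁻) (g , g⁻) = ∧-mono f g , ∧-mono f⁻ g⁻

∨-cong : A ≈ B → C ≈ D → A ∨ₘ C ≈ B ∨ₘ D
∨-cong (f , f⁻) (g , g⁻) = ∨-mono f g , ∨-mono f⁻ g⁻

⇒-cong : A ≈ B → C ≈ D → (A ⇒ₘ C) ≈ (B ⇒ₘ D)
⇒-cong (f , f⁻) (g , g⁻) = ⇒-mono f⁻ g , ⇒-mono f g⁻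

¬-cong : A ≈ B → ¬ₘ A ≈ ¬ₘ B
¬-cong (f , f⁻) = ¬-antitone f⁻ , ¬-antitone f

□-cong : A ≈ B → □ A ≈ □ B
□-cong (f , f⁻) = □-mono f , □-mono f⁻

taut≈ : ∀ n φ ψ → {PropositionalBelow n (φ ⇒ₘ ψ)} → {Valid n (λ _ → false) (φ ⇒ₘ ψ)}
      → {PropositionalBelow n (ψ ⇒ₘ φ)} → {Valid n (λ _ → false) (ψ ⇒ₘ φ)}
      → ∀ As → substₘ (assign As) φ ≈ substₘ (assign As) ψ
taut≈ n φ ψ {b} {v} {b⁻} {v⁻} As = taut n (φ ⇒ₘ ψ) {b} {v} As , taut n (ψ ⇒ₘ φ) {b⁻} {v⁻} As

⇒≈¬∨ : (A ⇒ₘ B) ≈ ¬ₘ A ∨ₘ B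
⇒≈¬∨ {A} {B} = taut≈ 2 (p₀ ⇒ₘ p₁) (¬ₘ p₀ ∨ₘ p₁) (A ∷ B ∷ [])

¬⇒≈∧¬ : ¬ₘ (A ⇒ₘ B) ≈ A ∧ₘ ¬ₘ B
¬⇒≈∧¬ {A} {B} = taut≈ 2 (¬ₘ (p₀ ⇒ₘ p₁)) (p₀ ∧ₘ ¬ₘ p₁) (A ∷ B ∷ [])

¬∧≈¬∨¬ : ¬ₘ (A ∧ₘ B) ≈ ¬ₘ A ∨ₘ ¬ₘ B
¬∧≈¬∨¬ {A} {B} = taut≈ 2 (¬ₘ (p₀ ∧ₘ p₁)) (¬ₘ p₀ ∨ₘ ¬ₘ p₁) (A ∷ B ∷ [])

¬∨≈¬∧¬ : ¬ₘ (A ∨ₘ B) ≈ ¬ₘ A ∧ₘ ¬ₘ B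
¬∨≈¬∧¬ {A} {B} = taut≈ 2 (¬ₘ (p₀ ∨ₘ p₁)) (¬ₘ p₀ ∧ₘ ¬ₘ p₁) (A ∷ B ∷ [])

¬-involutive : ¬ₘ ¬ₘ A ≈ A
¬-involutive {A} = taut≈ 1 (¬ₘ ¬ₘ p₀) p₀ (A ∷ [])

¬≈⇒⊥ : ¬ₘ A ≈ (A ⇒ₘ ⊥ₘ)
¬≈⇒⊥ {A} = taut≈ 1 (¬ₘ p₀) (p₀ ⇒ₘ ⊥ₘ) (A ∷ [])

⇒-identityˡ : S4⊢ A → (A ⇒ₘ B) ≈ B
⇒-identityˡ {A} {B} ⊢A = mp (taut 2 (p₀ ⇒ₘ (p₀ ⇒ₘ p₁) ⇒ₘ p₁) (A ∷ B ∷ [])) ⊢A , ax1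

∧-assoc : (A ∧ₘ B) ∧ₘ C ≈ A ∧ₘ (B ∧ₘ C)
∧-assoc {A} {B} {C} = taut≈ 3 ((p₀ ∧ₘ p₁) ∧ₘ p₂) (p₀ ∧ₘ (p₁ ∧ₘ p₂)) (A ∷ B ∷ C ∷ [])

∧-identityˡ : ⊤ₘ ∧ₘ A ≈ A
∧-identityˡ {A} = taut≈ 1 (⊤ₘ ∧ₘ p₀) p₀ (A ∷ [])

∧-identityʳ : A ∧ₘ ⊤ₘ ≈ A
∧-identityʳ {A} = taut≈ 1 (p₀ ∧ₘ ⊤ₘ) p₀ (A ∷ [])

∨-zeroˡ : ⊤ₘ ∨ₘ A ≈ ⊤ₘ
∨-zeroˡ {A} = taut≈ 1 (⊤ₘ ∨ₘ p₀) ⊤ₘ (A ∷ [])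

∨-zeroʳ : A ∨ₘ ⊤ₘ ≈ ⊤ₘ
∨-zeroʳ {A} = taut≈ 1 (p₀ ∨ₘ ⊤ₘ) ⊤ₘ (A ∷ [])

∨-distribˡ-∧ : A ∨ₘ (B ∧ₘ C) ≈ (A ∨ₘ B) ∧ₘ (A ∨ₘ C)
∨-distribˡ-∧ {A} {B} {C} =
  taut≈ 3 (p₀ ∨ₘ (p₁ ∧ₘ p₂)) ((p₀ ∨ₘ p₁) ∧ₘ (p₀ ∨ₘ p₂)) (A ∷ B ∷ C ∷ [])

∨-distribʳ-∧ : (B ∧ₘ C) ∨ₘ A ≈ (B ∨ₘ A) ∧ₘ (C ∨ₘ A)
∨-distribʳ-∧ {B} {C} {A} =
  taut≈ 3 ((p₀ ∧ₘ p₁) ∨ₘ p₂) ((p₀ ∨ₘ p₂) ∧ₘ (p₁ ∨ₘ p₂)) (B ∷ C ∷ A ∷ [])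

∧⇒∨≈⇒∨⇒ : (A ∧ₘ B ⇒ₘ C ∨ₘ D) ≈ (A ⇒ₘ C) ∨ₘ (B ⇒ₘ D)
∧⇒∨≈⇒∨⇒ {A} {B} {C} {D} =
  taut≈ 4 (p₀ ∧ₘ p₁ ⇒ₘ p₂ ∨ₘ p₃) ((p₀ ⇒ₘ p₂) ∨ₘ (p₁ ⇒ₘ p₃)) (A ∷ B ∷ C ∷ D ∷ [])

□-∧ : □ (A ∧ₘ B) ≈ □ A ∧ₘ □ B
□-∧ {A} {B} =
  mp₂ (taut 3 ((p₀ ⇒ₘ p₁) ⇒ₘ (p₀ ⇒ₘ p₂) ⇒ₘ p₀ ⇒ₘ p₁ ∧ₘ p₂) (□ (A ∧ₘ B) ∷ □ A ∷ □ B ∷ []))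
      (□-mono ax3) (□-mono ax4) ,
  mp₂ (taut 4 ((p₀ ⇒ₘ p₁) ⇒ₘ (p₁ ⇒ₘ p₂ ⇒ₘ p₃) ⇒ₘ p₀ ∧ₘ p₂ ⇒ₘ p₃)
              (□ A ∷ □ (B ⇒ₘ A ∧ₘ B) ∷ □ B ∷ □ (A ∧ₘ B) ∷ []))
      (□-mono ax5) axK

□-∨ : S4⊢ (□ A ∨ₘ □ B ⇒ₘ □ (A ∨ₘ B))
□-∨ {A} {B} =
  mp₂ (taut 3 ((p₀ ⇒ₘ p₂) ⇒ₘ (p₁ ⇒ₘ p₂) ⇒ₘ p₀ ∨ₘ p₁ ⇒ₘ p₂) (□ A ∷ □ B ∷ □ (A ∨ₘ B) ∷ []))
      (□-mono ax6) (□-mono ax7)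

□-⊤ : S4⊢ (□ ⊤ₘ)
□-⊤ = nec ⊤ₘ-intro

T-stable : ∀ φ → S4⊢ (T φ ⇒ₘ □ T φ)
T-stable (var p)  = ax4'
T-stable ⊥'       = ax9
T-stable (φ ∧' ψ) = ⇒-trans (∧-mono (T-stable φ) (T-stable ψ)) (proj₂ □-∧)
T-stable (φ ∨' ψ) = ⇒-trans (∨-mono (T-stable φ) (T-stable ψ)) □-∨
T-stable (¬' φ)   = ax4'
T-stable (φ ⇒ ψ)  = ax4'

□ᵛ : ℕ → MFm
□ᵛ p = □ var p

_* : MFm → MFm
β * = substₘ □ᵛ β

T-* : ∀ φ → T φ * ≈ T φ
T-* (var p)  = axT , ax4'
T-* ⊥'       = ≈-refl
T-* (φ ∧' ψ) = ∧-cong (T-* φ) (T-* ψ)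
T-* (φ ∨' ψ) = ∨-cong (T-* φ) (T-* ψ)
T-* (¬' φ)   = □-cong (¬-cong (T-* φ))
T-* (φ ⇒ ψ)  = □-cong (⇒-cong (T-* φ) (T-* ψ))

module _ (p : ℕ) where

  T-Pos : ∀ φ → Posₘ p (T φ) → Pos p φ
  T-Neg : ∀ φ → Negₘ p (T φ) → Neg p φ
  T-Pos (var q)  = id
  T-Pos ⊥'       = id
  T-Pos (φ ∧' ψ) = ⊎-map (T-Pos φ) (T-Pos ψ)
  T-Pos (φ ∨' ψ) = ⊎-map (T-Pos φ) (T-Pos ψ)
  T-Pos (¬' φ)   = T-Neg φ
  T-Pos (φ ⇒ ψ)  = ⊎-map (T-Neg φ) (T-Pos ψ)
  T-Neg (var q)  = id
  T-Neg ⊥'       = id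
  T-Neg (φ ∧' ψ) = ⊎-map (T-Neg φ) (T-Neg ψ)
  T-Neg (φ ∨' ψ) = ⊎-map (T-Neg φ) (T-Neg ψ)
  T-Neg (¬' φ)   = T-Pos φ
  T-Neg (φ ⇒ ψ)  = ⊎-map (T-Pos φ) (T-Neg ψ)

-- Clause normal form of β*

Clause : Set
Clause = IFm × IFm

clause : Clause → IFm
clause (a , b) = a ⇒ b

clauseₘ : Clause → MFm
clauseₘ (a , b) = T a ⇒ₘ T b

⊤' : IFm
⊤' = ¬' ⊥'

conj : List Clause → IFm
conj []       = ⊤'
conj (c ∷ cs) = clause c ∧' conj cs

conjₘ : List Clause → MFm
conjₘ []       = ⊤ₘ
conjₘ (c ∷ cs) = clauseₘ c ∧ₘ conjₘ cs

_⊙_ : Clause → Clause → Clause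
(a , b) ⊙ (a' , b') = a ∧' a' , b ∨' b'

_⊗_ : List Clause → List Clause → List Clause
_⊗_ = cartesianProductWith _⊙_

T-conj : ∀ cs → T (conj cs) ≈ □ conjₘ cs
T-conj []       = ≈-refl
T-conj (c ∷ cs) = ≈-trans (∧-cong ≈-refl (T-conj cs)) (≈-sym □-∧)

conjₘ-++ : ∀ xs ys → conjₘ (xs ++ ys) ≈ conjₘ xs ∧ₘ conjₘ ys
conjₘ-++ []       ys = ≈-sym ∧-identityˡ
conjₘ-++ (c ∷ xs) ys = ≈-trans (∧-cong ≈-refl (conjₘ-++ xs ys)) (≈-sym ∧-assoc)

clauseₘ-⊙ : ∀ x y → clauseₘ (x ⊙ y) ≈ clauseₘ x ∨ₘ clauseₘ y
clauseₘ-⊙ (a , b) (a' , b') = ∧⇒∨≈⇒∨⇒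

conjₘ-map-⊙ : ∀ x ys → conjₘ (map (x ⊙_) ys) ≈ clauseₘ x ∨ₘ conjₘ ys
conjₘ-map-⊙ x []       = ≈-sym ∨-zeroʳ
conjₘ-map-⊙ x (y ∷ ys) = ≈-trans (∧-cong (clauseₘ-⊙ x y) (conjₘ-map-⊙ x ys)) (≈-sym ∨-distribˡ-∧)

conjₘ-⊗ : ∀ xs ys → conjₘ (xs ⊗ ys) ≈ conjₘ xs ∨ₘ conjₘ ys
conjₘ-⊗ []       ys = ≈-sym ∨-zeroˡ
conjₘ-⊗ (x ∷ xs) ys = begin
  conjₘ (map (x ⊙_) ys ++ xs ⊗ ys)                     ≈⟨ conjₘ-++ (map (x ⊙_) ys) (xs ⊗ ys) ⟩
  conjₘ (map (x ⊙_) ys) ∧ₘ conjₘ (xs ⊗ ys)             ≈⟨ ∧-cong (conjₘ-map-⊙ x ys) (conjₘ-⊗ xs ys) ⟩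
  (clauseₘ x ∨ₘ conjₘ ys) ∧ₘ (conjₘ xs ∨ₘ conjₘ ys)    ≈⟨ ∨-distribʳ-∧ ⟨
  (clauseₘ x ∧ₘ conjₘ xs) ∨ₘ conjₘ ys                  ∎
  where open ≈-Reasoning

conjₘ-⊤-clause : ∀ b → T b ≈ conjₘ ((⊤' , b) ∷ [])
conjₘ-⊤-clause b = ≈-sym (≈-trans ∧-identityʳ (⇒-identityˡ □-⊤))

conjₘ-⊥-clause : ∀ a → ¬ₘ T a ≈ conjₘ ((a , ⊥') ∷ [])
conjₘ-⊥-clause a = ≈-trans ¬≈⇒⊥ (≈-sym ∧-identityʳ)

posClauses negClauses : MFm → List Clause
posClauses (var p)  = (⊤' , var p) ∷ []
posClauses ⊥ₘ       = (⊤' , ⊥') ∷ []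
posClauses (β ∧ₘ γ) = posClauses β ++ posClauses γ
posClauses (β ∨ₘ γ) = posClauses β ⊗ posClauses γ
posClauses (¬ₘ β)   = negClauses β
posClauses (β ⇒ₘ γ) = negClauses β ⊗ posClauses γ
posClauses (□ β)    = (⊤' , conj (posClauses β)) ∷ []
negClauses (var p)  = (var p , ⊥') ∷ []
negClauses ⊥ₘ       = []
negClauses (β ∧ₘ γ) = negClauses β ⊗ negClauses γ
negClauses (β ∨ₘ γ) = negClauses β ++ negClauses γ
negClauses (¬ₘ β)   = posClauses β
negClauses (β ⇒ₘ γ) = posClauses β ++ negClauses γ
negClauses (□ β)    = (conj (posClauses β) , ⊥') ∷ []

≈-conjₘ-∧ : ∀ {xs ys} → A ≈ conjₘ xs → B ≈ conjₘ ys → A ∧ₘ B ≈ conjₘ (xs ++ ys)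
≈-conjₘ-∧ {xs = xs} {ys} f g = ≈-trans (∧-cong f g) (≈-sym (conjₘ-++ xs ys))

≈-conjₘ-∨ : ∀ {xs ys} → A ≈ conjₘ xs → B ≈ conjₘ ys → A ∨ₘ B ≈ conjₘ (xs ⊗ ys)
≈-conjₘ-∨ {xs = xs} {ys} f g = ≈-trans (∨-cong f g) (≈-sym (conjₘ-⊗ xs ys))

posClauses-sound : ∀ β → β * ≈ conjₘ (posClauses β)
negClauses-sound : ∀ β → ¬ₘ (β *) ≈ conjₘ (negClauses β)
posClauses-sound (var p)  = conjₘ-⊤-clause (var p)
posClauses-sound ⊥ₘ       = conjₘ-⊤-clause ⊥'
posClauses-sound (β ∧ₘ γ) = ≈-conjₘ-∧ (posClauses-sound β) (posClauses-sound γ)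
posClauses-sound (β ∨ₘ γ) = ≈-conjₘ-∨ (posClauses-sound β) (posClauses-sound γ)
posClauses-sound (¬ₘ β)   = negClauses-sound β
posClauses-sound (β ⇒ₘ γ) = ≈-trans ⇒≈¬∨ (≈-conjₘ-∨ (negClauses-sound β) (posClauses-sound γ))
posClauses-sound (□ β)    = begin
  □ (β *)                   ≈⟨ □-cong (posClauses-sound β) ⟩
  □ conjₘ (posClauses β)    ≈⟨ T-conj (posClauses β) ⟨
  T (conj (posClauses β))   ≈⟨ conjₘ-⊤-clause (conj (posClauses β)) ⟩
  conjₘ (posClauses (□ β))  ∎
  where open ≈-Reasoning
negClauses-sound (var p)  = conjₘ-⊥-clause (var p)
negClauses-sound ⊥ₘ       = ≈-refl
negClauses-sound (β ∧ₘ γ) = ≈-trans ¬∧≈¬∨¬ (≈-conjₘ-∨ (negClauses-sound β) (negClauses-sound γ))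
negClauses-sound (β ∨ₘ γ) = ≈-trans ¬∨≈¬∧¬ (≈-conjₘ-∧ (negClauses-sound β) (negClauses-sound γ))
negClauses-sound (¬ₘ β)   = ≈-trans ¬-involutive (posClauses-sound β)
negClauses-sound (β ⇒ₘ γ) = ≈-trans ¬⇒≈∧¬ (≈-conjₘ-∧ (posClauses-sound β) (negClauses-sound γ))
negClauses-sound (□ β)    = begin
  ¬ₘ □ (β *)                   ≈⟨ ¬-cong (□-cong (posClauses-sound β)) ⟩
  ¬ₘ □ conjₘ (posClauses β)    ≈⟨ ¬-cong (T-conj (posClauses β)) ⟨
  ¬ₘ T (conj (posClauses β))   ≈⟨ conjₘ-⊥-clause (conj (posClauses β)) ⟩
  conjₘ (negClauses (□ β))     ∎
  where open ≈-Reasoning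

untranslate : MFm → IFm
untranslate β = conj (posClauses β)

T-untranslate : ∀ β → T (untranslate β) ≈ □ (β *)
T-untranslate β = ≈-trans (T-conj (posClauses β)) (□-cong (≈-sym (posClauses-sound β)))

module _ {P : Clause → Set} (P-⊙ : ∀ x y → P (x ⊙ y) → P x ⊎ P y) where

  Any-⊗ : ∀ xs ys → Any P (xs ⊗ ys) → Any P xs ⊎ Any P ys
  Any-⊗ xs ys h with find h
  ... | _ , v∈ , Pv with ∈-cartesianProductWith⁻ _⊙_ xs ys v∈
  ... | x , y , x∈ , y∈ , refl = ⊎-map (lose x∈) (lose y∈) (P-⊙ x y Pv)

⊎-interchange : ∀ {a b c d} {P : Set a} {Q : Set b} {R : Set c} {S : Set d}
              → (P ⊎ Q) ⊎ (R ⊎ S) → (P ⊎ R) ⊎ (Q ⊎ S)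
⊎-interchange = [ ⊎-map inj₁ inj₁ , ⊎-map inj₂ inj₂ ]′

module _ (p : ℕ) where

  conj-Pos : ∀ cs → Pos p (conj cs) → Any (Pos p ∘ clause) cs
  conj-Pos (c ∷ cs) = [ here , there ∘ conj-Pos cs ]′

  conj-Neg : ∀ cs → Neg p (conj cs) → Any (Neg p ∘ clause) cs
  conj-Neg (c ∷ cs) = [ here , there ∘ conj-Neg cs ]′

  ⊙-Pos : ∀ x y → Pos p (clause (x ⊙ y)) → Pos p (clause x) ⊎ Pos p (clause y)
  ⊙-Pos (a , b) (a' , b') = ⊎-interchange

  ⊙-Neg : ∀ x y → Neg p (clause (x ⊙ y)) → Neg p (clause x) ⊎ Neg p (clause y)
  ⊙-Neg (a , b) (a' , b') = ⊎-interchange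

  posClauses-Pos : ∀ β → Any (Pos p ∘ clause) (posClauses β) → Posₘ p β
  posClauses-Neg : ∀ β → Any (Neg p ∘ clause) (posClauses β) → Negₘ p β
  negClauses-Pos : ∀ β → Any (Pos p ∘ clause) (negClauses β) → Negₘ p β
  negClauses-Neg : ∀ β → Any (Neg p ∘ clause) (negClauses β) → Posₘ p β
  posClauses-Pos (var q)  = [ ⊥-elim , id ]′ ∘ singleton⁻
  posClauses-Pos ⊥ₘ       = [ ⊥-elim , ⊥-elim ]′ ∘ singleton⁻
  posClauses-Pos (β ∧ₘ γ) = ⊎-map (posClauses-Pos β) (posClauses-Pos γ) ∘ ++⁻ (posClauses β)
  posClauses-Pos (β ∨ₘ γ) =
    ⊎-map (posClauses-Pos β) (posClauses-Pos γ) ∘ Any-⊗ ⊙-Pos (posClauses β) (posClauses γ)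
  posClauses-Pos (¬ₘ β)   = negClauses-Pos β
  posClauses-Pos (β ⇒ₘ γ) =
    ⊎-map (negClauses-Pos β) (posClauses-Pos γ) ∘ Any-⊗ ⊙-Pos (negClauses β) (posClauses γ)
  posClauses-Pos (□ β)    = [ ⊥-elim , posClauses-Pos β ∘ conj-Pos (posClauses β) ]′ ∘ singleton⁻
  posClauses-Neg (var q)  = [ ⊥-elim , ⊥-elim ]′ ∘ singleton⁻
  posClauses-Neg ⊥ₘ       = [ ⊥-elim , ⊥-elim ]′ ∘ singleton⁻
  posClauses-Neg (β ∧ₘ γ) = ⊎-map (posClauses-Neg β) (posClauses-Neg γ) ∘ ++⁻ (posClauses β)
  posClauses-Neg (β ∨ₘ γ) =
    ⊎-map (posClauses-Neg β) (posClauses-Neg γ) ∘ Any-⊗ ⊙-Neg (posClauses β) (posClauses γ)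
  posClauses-Neg (¬ₘ β)   = negClauses-Neg β
  posClauses-Neg (β ⇒ₘ γ) =
    ⊎-map (negClauses-Neg β) (posClauses-Neg γ) ∘ Any-⊗ ⊙-Neg (negClauses β) (posClauses γ)
  posClauses-Neg (□ β)    = [ ⊥-elim , posClauses-Neg β ∘ conj-Neg (posClauses β) ]′ ∘ singleton⁻
  negClauses-Pos (var q)  = [ ⊥-elim , ⊥-elim ]′ ∘ singleton⁻
  negClauses-Pos ⊥ₘ       = λ ()
  negClauses-Pos (β ∧ₘ γ) =
    ⊎-map (negClauses-Pos β) (negClauses-Pos γ) ∘ Any-⊗ ⊙-Pos (negClauses β) (negClauses γ)
  negClauses-Pos (β ∨ₘ γ) = ⊎-map (negClauses-Pos β) (negClauses-Pos γ) ∘ ++⁻ (negClauses β)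
  negClauses-Pos (¬ₘ β)   = posClauses-Pos β
  negClauses-Pos (β ⇒ₘ γ) = ⊎-map (posClauses-Pos β) (negClauses-Pos γ) ∘ ++⁻ (posClauses β)
  negClauses-Pos (□ β)    = [ posClauses-Neg β ∘ conj-Neg (posClauses β) , ⊥-elim ]′ ∘ singleton⁻
  negClauses-Neg (var q)  = [ id , ⊥-elim ]′ ∘ singleton⁻
  negClauses-Neg ⊥ₘ       = λ ()
  negClauses-Neg (β ∧ₘ γ) =
    ⊎-map (negClauses-Neg β) (negClauses-Neg γ) ∘ Any-⊗ ⊙-Neg (negClauses β) (negClauses γ)
  negClauses-Neg (β ∨ₘ γ) = ⊎-map (negClauses-Neg β) (negClauses-Neg γ) ∘ ++⁻ (negClauses β)
  negClauses-Neg (¬ₘ β)   = posClauses-Neg β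
  negClauses-Neg (β ⇒ₘ γ) = ⊎-map (posClauses-Neg β) (negClauses-Neg γ) ∘ ++⁻ (posClauses β)
  negClauses-Neg (□ β)    = [ posClauses-Pos β ∘ conj-Pos (posClauses β) , ⊥-elim ]′ ∘ singleton⁻

  untranslate-Pos : ∀ β → Pos p (untranslate β) → Posₘ p β
  untranslate-Pos β = posClauses-Pos β ∘ conj-Pos (posClauses β)

  untranslate-Neg : ∀ β → Neg p (untranslate β) → Negₘ p β
  untranslate-Neg β = posClauses-Neg β ∘ conj-Neg (posClauses β)

module Companion {L : IFm → Set} {M : MFm → Set} (companion : ModalCompanion L M) where
  open IsNormalExtS4 (proj₁ companion)

  infix 4 _≲_

  _≲_ : MFm → MFm → Set
  A ≲ B = M (A ⇒ₘ B)

  ≲-preorder : Preorder 0ℓ 0ℓ 0ℓ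
  ≲-preorder = record
    { Carrier    = MFm
    ; _≈_        = _≡_
    ; _≲_        = _≲_
    ; isPreorder = record
      { isEquivalence = isEquivalence
      ; reflexive     = λ { refl → s4⊆ ⇒-refl }
      ; trans         = λ f g → mpClosed (mpClosed (s4⊆ syllogism) f) g
      }
    }

  open Relation.Binary.Reasoning.Preorder ≲-preorder

  □-mono-≲ : A ≲ B → □ A ≲ □ B
  □-mono-≲ f = mpClosed (s4⊆ axK) (necClosed f)

  reflect-⇒ : ∀ {φ ψ} → T φ ≲ T ψ → L (φ ⇒ ψ)
  reflect-⇒ {φ} {ψ} f = proj₂ (proj₂ companion (φ ⇒ ψ)) (necClosed f)

  preserve-⇒ : ∀ {φ ψ} → L (φ ⇒ ψ) → T φ ≲ T ψ
  preserve-⇒ {φ} {ψ} h = mpClosed (s4⊆ axT) (proj₁ (proj₂ companion (φ ⇒ ψ)) h)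

  ulip-transfer : ULIPₘ M → ULIP L
  ulip-transfer M-ulip φ P⁺ P⁻ with M-ulip (T φ) P⁺ P⁻
  ... | α , Tφ≲α , α-pos , α-neg , α-uniform =
    untranslate α , φ⇒θ , (λ q → map₁ (T-Pos q φ) ∘ α-pos q ∘ untranslate-Pos q α)
                        , (λ q → map₁ (T-Neg q φ) ∘ α-neg q ∘ untranslate-Neg q α) , uniform
    where
    φ⇒θ : L (φ ⇒ untranslate α)
    φ⇒θ = reflect-⇒ (begin
      T φ                ≲⟨ s4⊆ (T-stable φ) ⟩
      □ T φ              ≲⟨ □-mono-≲ (s4⊆ (proj₂ (T-* φ))) ⟩
      □ (T φ *)          ≲⟨ □-mono-≲ (substClosed □ᵛ Tφ≲α) ⟩
      □ (α *)            ≲⟨ s4⊆ (proj₂ (T-untranslate α)) ⟩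
      T (untranslate α)  ∎)

    uniform : ∀ ψ → L (φ ⇒ ψ) → (∀ q → Pos q ψ → q ∉ P⁺) → (∀ q → Neg q ψ → q ∉ P⁻)
            → L (untranslate α ⇒ ψ)
    uniform ψ φ⇒ψ ψ-pos ψ-neg = reflect-⇒ (begin
      T (untranslate α)  ≲⟨ s4⊆ (proj₁ (T-untranslate α)) ⟩
      □ (α *)            ≲⟨ s4⊆ axT ⟩
      α *                ≲⟨ substClosed □ᵛ α≲Tψ ⟩
      T ψ *              ≲⟨ s4⊆ (proj₁ (T-* ψ)) ⟩
      T ψ                ∎)
      where
      α≲Tψ : α ≲ T ψ
      α≲Tψ = α-uniform (T ψ) (preserve-⇒ φ⇒ψ)
                       (λ q → ψ-pos q ∘ T-Pos q ψ) (λ q → ψ-neg q ∘ T-Neg q ψ)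

proposition10p7 : (L : IFm → Set) → IsIntermediate L
    → Σ (MFm → Set) (λ M → ModalCompanion L M × ULIPₘ M)
    → ULIP L
proposition10p7 L _ (M , companion , M-ulip) = Companion.ulip-transfer companion M-ulip
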